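{- Let $G$ be a connected finite simple graph containing none of the claw, the co-diamond, $C_4$ as an induced subgraph, with $\alpha(G)=3$ and containing a triangle. Let $\{a,b,c\}$ be a stable set of size $3$ in $G$, and for distinct $x,y\in\{a,b,c\}$ let $S_{x,y}$ be the set of vertices outside $\{a,b,c\}$ adjacent to both $x$ and $y$. Then each $S_{x,y}$ induces a clique in $G$.
   Context: $\alpha(G)$ is the maximum size of a stable set in $G$. Claw $=K_{1,3}$; co-diamond $=$ one edge plus two isolated vertices; $C_4$ is the chordless 4-cycle. (In such a graph every vertex outside $\{a,b,c\}$ is adjacent to exactly two of $a,b,c$.) -}

module Defs where

open import Data.Nat using (ℕ; suc)
open import Data.Fin using (Fin)
open import Data.Product using (Σ; _×_; _,_; ∃)
open import Relation.Binary.PropositionalEquality using (_≡_)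
open import Relation.Nullary using (¬_; Dec)
open import Level using (0ℓ)

record Graph (n : ℕ) : Set₁ where
  field
    Adj      : Fin n → Fin n → Set
    adj?     : ∀ u v → Dec (Adj u v)
    irrefl   : ∀ v → ¬ Adj v v
    sym      : ∀ {u v} → Adj u v → Adj v u

module _ {n : ℕ} (G : Graph n) where
  open Graph G

  NonAdj : Fin n → Fin n → Set
  NonAdj u v = ¬ Adj u v

  data Walk : Fin n → Fin n → Set where
    here  : ∀ {v} → Walk v v
    step  : ∀ {u w v} → Adj u w → Walk w v → Walk u v

  Connected : Set
  Connected = ∀ u v → Walk u v

  IsInducedClaw : Fin n → Fin n → Fin n → Fin n → Set
  IsInducedClaw c x y z =
    Adj c x × Adj c y × Adj c z ×
    NonAdj x y × NonAdj x z × NonAdj y z ×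
    ¬ x ≡ y × ¬ x ≡ z × ¬ y ≡ z

  HasInducedClaw : Set
  HasInducedClaw = Σ (Fin n) λ c → Σ (Fin n) λ x → Σ (Fin n) λ y → Σ (Fin n) λ z →
    IsInducedClaw c x y z

  IsInducedCoDiamond : Fin n → Fin n → Fin n → Fin n → Set
  IsInducedCoDiamond x y z w =
    Adj x y × NonAdj x z × NonAdj x w × NonAdj y z × NonAdj y w × NonAdj z w ×
    ¬ x ≡ y × ¬ x ≡ z × ¬ x ≡ w × ¬ y ≡ z × ¬ y ≡ w × ¬ z ≡ w

  HasInducedCoDiamond : Set
  HasInducedCoDiamond = Σ (Fin n) λ x → Σ (Fin n) λ y → Σ (Fin n) λ z → Σ (Fin n) λ w →
    IsInducedCoDiamond x y z w

  IsInducedC4 : Fin n → Fin n → Fin n → Fin n → Set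
  IsInducedC4 x y z w =
    Adj x y × Adj y z × Adj z w × Adj w x × NonAdj x z × NonAdj y w ×
    ¬ x ≡ y × ¬ x ≡ z × ¬ x ≡ w × ¬ y ≡ z × ¬ y ≡ w × ¬ z ≡ w

  HasInducedC4 : Set
  HasInducedC4 = Σ (Fin n) λ x → Σ (Fin n) λ y → Σ (Fin n) λ z → Σ (Fin n) λ w →
    IsInducedC4 x y z w

  HasTriangle : Set
  HasTriangle = Σ (Fin n) λ x → Σ (Fin n) λ y → Σ (Fin n) λ z →
    Adj x y × Adj y z × Adj x z

  Stable3 : Fin n → Fin n → Fin n → Set
  Stable3 a b c = NonAdj a b × NonAdj a c × NonAdj b c ×
                  ¬ a ≡ b × ¬ a ≡ c × ¬ b ≡ c

  Stable4 : Fin n → Fin n → Fin n → Fin n → Set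
  Stable4 a b c d = Stable3 a b c × NonAdj a d × NonAdj b d × NonAdj c d ×
                    ¬ a ≡ d × ¬ b ≡ d × ¬ c ≡ d

  -- α(G) = 3: a stable set of size 3 exists and none of size 4 exists
  -- (hence none larger, since subsets of stable sets are stable).
  Alpha≡3 : Set
  Alpha≡3 = (Σ (Fin n) λ a → Σ (Fin n) λ b → Σ (Fin n) λ c → Stable3 a b c)
          × (∀ a b c d → ¬ Stable4 a b c d)

  InS : Fin n → Fin n → Fin n → Fin n → Fin n → Fin n → Set
  InS a b c x y v = ¬ v ≡ a × ¬ v ≡ b × ¬ v ≡ c × Adj v x × Adj v y

  IsClique : (Fin n → Set) → Set
  IsClique P = ∀ u v → P u → P v → ¬ u ≡ v → Adj u v

module Submission where

-- In a C4-free graph, the common neighbours of two distinct nonadjacent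
-- vertices x, y are pairwise adjacent: if u, v were two nonadjacent common
-- neighbours, then x u y v x would be an induced 4-cycle.  Distinctness of
-- the four vertices is automatic, since u and v are adjacent to x and y
-- (adjacency is irreflexive) and x ≢ y, u ≢ v are given.
--
-- Each S_{x,y} of the theorem is a subset of the common neighbourhood of the
-- two nonadjacent vertices x, y of the stable triple, so each is a clique.

open import Defs
open import Data.Nat using (ℕ)
open import Data.Fin using (Fin)
open import Data.Product using (_×_; _,_)
open import Relation.Nullary using (¬_; yes; no; contradiction)
open import Relation.Binary.PropositionalEquality using (_≡_; refl)

module _ {n : ℕ} (G : Graph n) where
  open Graph G

  adj⇒≢ : ∀ {u v} → Adj u v → ¬ u ≡ v
  adj⇒≢ {u} uv refl = irrefl u uv

  CommonNbr : Fin n → Fin n → Fin n → Set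
  CommonNbr x y v = Adj v x × Adj v y

  commonNbrs⇒C4 : ∀ {x y u v} → NonAdj G x y → ¬ x ≡ y →
    CommonNbr x y u → CommonNbr x y v → NonAdj G u v → ¬ u ≡ v →
    IsInducedC4 G x u y v
  commonNbrs⇒C4 nxy x≢y (ux , uy) (vx , vy) nuv u≢v =
    sym ux , uy , sym vy , vx , nxy , nuv ,
    adj⇒≢ (sym ux) , x≢y , adj⇒≢ (sym vx) , adj⇒≢ uy , u≢v , adj⇒≢ (sym vy)

  commonNbrs-clique : ¬ HasInducedC4 G → ∀ {x y} → NonAdj G x y → ¬ x ≡ y →
    (P : Fin n → Set) → (∀ v → P v → CommonNbr x y v) → IsClique G P
  commonNbrs-clique noC4 {x} {y} nxy x≢y P P⊆N u v Pu Pv u≢v with adj? u v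
  ... | yes uv = uv
  ... | no nuv = contradiction
          (x , u , y , v , commonNbrs⇒C4 nxy x≢y (P⊆N u Pu) (P⊆N v Pv) nuv u≢v)
          noC4

  S⊆CommonNbr : ∀ a b c x y v → InS G a b c x y v → CommonNbr x y v
  S⊆CommonNbr a b c x y v (_ , _ , _ , vx , vy) = vx , vy

mainTheorem10 : (n : ℕ) (G : Graph n) →
    Connected G → ¬ HasInducedClaw G → ¬ HasInducedCoDiamond G → ¬ HasInducedC4 G →
    Alpha≡3 G → HasTriangle G →
    (a b c : Fin n) → Stable3 G a b c →
    IsClique G (InS G a b c a b) × IsClique G (InS G a b c a c) × IsClique G (InS G a b c b c)
mainTheorem10 n G _ _ _ noC4 _ _ a b c (nab , nac , nbc , a≢b , a≢c , b≢c) =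
  S-clique nab a≢b , S-clique nac a≢c , S-clique nbc b≢c
  where
  S-clique : ∀ {x y} → NonAdj G x y → ¬ x ≡ y → IsClique G (InS G a b c x y)
  S-clique nxy x≢y =
    commonNbrs-clique G noC4 nxy x≢y (InS G a b c _ _) (S⊆CommonNbr G a b c _ _)
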